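{- Let $t=(t_1,\dots,t_k)$ be a composition of $n$ and write $[t]_i=t_1+\cdots+t_i$ and $[t]_i!=[t]_1[t]_2\cdots[t]_i$. The number of restricted flags of $[n]$ of type $t$ is \[ \binom{n}{t_1,\dots,t_k}\frac{t_1t_2\cdots t_k}{[t]_k!}=\frac{1}{n}\binom{n}{t_1,\dots,t_k}\frac{t_1t_2\cdots t_k}{[t]_{k-1}!}. \]
   Context: A restricted flag of $[n]=\{1,\dots,n\}$ of length $k$ is a chain of subsets $\emptyset=S_0\subseteq S_1\subseteq\cdots\subseteq S_k=[n]$ such that for each $i=1,\dots,k-1$ the maximum element of $S_{i+1}$ does not belong to $S_i$. It has type $t=(t_1,\dots,t_k)$ if $t_i=|S_i\setminus S_{i-1}|$ for $i=1,\dots,k$; here $t$ is required to be a composition (all $t_i\ge1$). -}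

module Defs where

open import Data.Bool using (Bool; true; false)
import Data.Bool.Properties as BoolP
open import Data.Nat using (ℕ; zero; suc; _+_; _*_; _∸_; _≤_; _≤?_; NonZero; _/_)
open import Data.Nat.Properties using (_!≢0; m*n≢0)
import Data.Nat.Properties as ℕP
open import Data.Nat.Combinatorics using ()
open import Data.Nat.Base using (_!)
open import Data.Fin using (Fin; zero; suc; toℕ; inject₁; fromℕ)
open import Data.Fin.Properties using (all?)
open import Data.Fin.Subset using (Subset; _∈_; _∉_; _⊆_; _─_; ∣_∣; ⊥; ⊤)
open import Data.Fin.Subset.Properties using (_∈?_; _⊆?_)
open import Data.List using (List; []; _∷_; length; lookup; take; map; applyUpTo; filter; concatMap)
open import Data.Nat.ListAction using (sum; product)
open import Data.Vec using (Vec; []; _∷_) renaming (lookup to vlookup)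
open import Data.Vec.Properties using (≡-dec)
open import Data.Product using (_×_; _,_)
open import Data.Product.Properties using () 
open import Relation.Binary.PropositionalEquality using (_≡_)
open import Relation.Nullary using (Dec; ¬?; _×-dec_; _→-dec_)

IsComposition : ℕ → List ℕ → Set
IsComposition n t = ((i : Fin (length t)) → 1 ≤ lookup t i) × (sum t ≡ n)

[_]_ : List ℕ → ℕ → ℕ
[ t ] i = sum (take i t)

[_]_! : List ℕ → ℕ → ℕ
[ t ] i ! = product (applyUpTo (λ j → [ t ] (suc j)) i)

factProd : List ℕ → ℕ
factProd t = product (map _! t)

factProd≢0 : (t : List ℕ) → NonZero (factProd t)
factProd≢0 [] = _
factProd≢0 (x ∷ t) = m*n≢0 (x !) (factProd t) {{x !≢0}} {{factProd≢0 t}}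

multinomial : ℕ → List ℕ → ℕ
multinomial n t = (n !) / factProd t
  where instance _ = factProd≢0 t

-- Flags of [n] of length k:  (S₀, S₁, …, S_k), stored as a vector of
-- k+1 subsets of Fin n (element x : Fin n stands for x+1 ∈ [n]).

Flag : ℕ → ℕ → Set
Flag n k = Vec (Subset n) (suc k)

module _ {n : ℕ} (t : List ℕ) (S : Flag n (length t)) where
  private
    k = length t
    S[_] : Fin (suc k) → Subset n
    S[ i ] = vlookup S i

  IsChain : Set
  IsChain = (S[ zero ] ≡ ⊥) × (S[ fromℕ k ] ≡ ⊤)
          × ((i : Fin k) → S[ inject₁ i ] ⊆ S[ suc i ])

  -- for each i = 1,…,k-1 : the maximum element of S_{i+1} is not in S_i.
  -- (Here i ranges over Fin k, S[ suc i ] = S_{i+1}, S[ inject₁ i ] = S_i.)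
  IsRestricted : Set
  IsRestricted = (i : Fin k) → 1 ≤ toℕ i →
    (x : Fin n) → x ∈ S[ suc i ] → ((y : Fin n) → y ∈ S[ suc i ] → toℕ y ≤ toℕ x) →
    x ∉ S[ inject₁ i ]

  HasType : Set
  HasType = (i : Fin k) → ∣ S[ suc i ] ─ S[ inject₁ i ] ∣ ≡ lookup t i

  IsRestrictedFlagOfType : Set
  IsRestrictedFlagOfType = IsChain × IsRestricted × HasType

  isRestrictedFlagOfType? : Dec IsRestrictedFlagOfType
  isRestrictedFlagOfType? =
    (≡-dec BoolP._≟_ S[ zero ] ⊥ ×-dec ≡-dec BoolP._≟_ S[ fromℕ k ] ⊤
      ×-dec all? (λ i → S[ inject₁ i ] ⊆? S[ suc i ]))
    ×-dec (all? (λ i → (1 ≤? toℕ i) →-dec all? (λ x →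
             (x ∈? S[ suc i ]) →-dec
             (all? (λ y → (y ∈? S[ suc i ]) →-dec (toℕ y ≤? toℕ x)) →-dec
              ¬? (x ∈? S[ inject₁ i ])))))
    ×-dec all? (λ i → ∣ S[ suc i ] ─ S[ inject₁ i ] ∣ ℕP.≟ lookup t i)

allVecs : {A : Set} → List A → (m : ℕ) → List (Vec A m)
allVecs xs zero = [] ∷ []
allVecs xs (suc m) = concatMap (λ x → map (x ∷_) (allVecs xs m)) xs

allSubsets : (n : ℕ) → List (Subset n)
allSubsets n = allVecs (true ∷ false ∷ []) n

allFlags : (n k : ℕ) → List (Flag n k)
allFlags n k = allVecs (allSubsets n) (suc k)

numRestrictedFlags : (n : ℕ) → List ℕ → ℕ
numRestrictedFlags n t =
  length (filter (isRestrictedFlagOfType? t) (allFlags n (length t)))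

{-# OPTIONS --safe #-}
-- Generalise the type to a marked type: a list of step sizes aᵢ, each marked
-- if step i must satisfy the restriction max Sᵢ ∉ Sᵢ₋₁ (for restricted flags
-- of type t every step but the first is marked).  Flags of a marked type are
-- counted by induction on n, deleting the largest element.  If it enters at
-- step j, the restriction holds at step j automatically and fails at every
-- later step; so such flags exist only when aⱼ ≥ 1 and no later step is
-- marked, and deleting the element leaves a flag of [n] whose type has aⱼ
-- lowered by one and step j unmarked.  The closed form
--   N · ∏_{i marked} [a]ᵢ · ∏ᵢ aᵢ! = n! · ∏_{i marked} aᵢ
-- is compatible with this recursion: compared with the closed form of the
-- shrunk type, the j-th term gains the factor aⱼ, or [a]ⱼ if j is the last
-- marked step m, and these factors add up to [a]ₘ + aₘ₊₁ + ⋯ + a_k = n + 1.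
module Submission where

open import Defs
open import Data.Nat using (ℕ; _*_; _∸_; _≤_)
open import Data.List using (List; length)
open import Data.Nat.ListAction using (product)
open import Data.Product using (_×_)
open import Relation.Binary.PropositionalEquality using (_≡_)

open import Algebra.Bundles using (CommutativeMonoid)
import Algebra.Properties.CommutativeSemigroup as CommSemigroupProperties
open import Data.Bool as Bool using (Bool; true; false; not; _∧_; _∨_; if_then_else_; T)
open import Data.Bool.Properties using (∧-identityʳ; ∧-zeroʳ; ∨-identityʳ; ∨-zeroʳ; if-eta; ∧-commutativeMonoid)
import Data.Empty as Empty
open import Data.Fin using (Fin; zero; suc; toℕ; inject₁; fromℕ)
open import Data.Fin.Subset using (Subset; _∈_; _∉_; _⊆_; _─_; ∣_∣; ⊥; ⊤)
open import Data.Fin.Subset.Properties using (_⊆?_; ∉⊥; Empty-unique)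
open import Data.List as List using ([]; _∷_; map; concatMap; _++_; filter; allFin; applyUpTo)
open import Data.List.Properties using (map-cong; map-∘; map-++; map-tabulate; applyUpTo-∷ʳ; take-all)
open import Data.Nat using (zero; suc; _+_; _<ᵇ_; _≤ᵇ_; _/_; z≤n; s≤s)
open import Data.Nat using () renaming (_! to factorial)
open import Data.Nat.DivMod using (m*n/n≡m)
open import Data.Nat.ListAction using (sum)
open import Data.Nat.ListAction.Properties using (sum-++; product-++)
open import Data.Nat.Properties
  using (_≟_; +-identityʳ; +-assoc; +-suc; *-identityˡ; *-identityʳ; *-zeroʳ; *-comm; *-assoc; *-distribˡ-+
        ; *-cancelʳ-≡; suc-injective; ≤-refl; ≤-pred; ≤ᵇ⇒≤; ≤⇒≤ᵇ; +-commutativeSemigroup; *-commutativeSemigroup)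
open import Data.Nat.Tactic.RingSolver using (solve-∀)
open import Data.Product using (_,_; proj₁; proj₂; ∃-syntax)
open import Data.Vec as Vec using (Vec; []; _∷_; _∷ʳ_; head; zipWith; replicate; here; there)
open import Data.Vec.Properties using (≡-dec)
open import Function using (_∘_; id; case_of_)
open import Function.Bundles using (_⇔_; mk⇔; Equivalence)
open import Relation.Binary.Definitions using (DecidableEquality)
open import Relation.Binary.PropositionalEquality using (refl; sym; trans; cong; cong₂; module ≡-Reasoning)
open import Relation.Nullary using (Dec; yes; no; does; _because_; contradiction; _×-dec_; _→-dec_)
open import Relation.Nullary.Decidable using (T?; does-⇔)
open import Relation.Nullary.Reflects using (fromEquivalence)

open Equivalence using (to; from)

private
  module +-CS = CommSemigroupProperties +-commutativeSemigroup
  module *-CS = CommSemigroupProperties *-commutativeSemigroup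
  module ∧-CS = CommSemigroupProperties (CommutativeMonoid.commutativeSemigroup ∧-commutativeMonoid)

⟦_⟧ : Bool → ℕ
⟦ true ⟧  = 1
⟦ false ⟧ = 0

⟦∧⟧ : ∀ x y → ⟦ x ∧ y ⟧ ≡ ⟦ x ⟧ * ⟦ y ⟧
⟦∧⟧ true  y = sym (+-identityʳ ⟦ y ⟧)
⟦∧⟧ false y = refl

⟦∧⟧-interchange : ∀ w x y z → ⟦ w ∧ x ⟧ * ⟦ y ∧ z ⟧ ≡ ⟦ (w ∧ y) ∧ (x ∧ z) ⟧
⟦∧⟧-interchange w x y z = trans (sym (⟦∧⟧ (w ∧ x) (y ∧ z))) (cong ⟦_⟧ (∧-CS.interchange w x y z))

⟦⟧-*-cong : ∀ b {x y} → (T b → x ≡ y) → ⟦ b ⟧ * x ≡ ⟦ b ⟧ * y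
⟦⟧-*-cong true  x≡y = cong (1 *_) (x≡y _)
⟦⟧-*-cong false x≡y = refl

⟦⟧-T : ∀ {b} → T b → ⟦ b ⟧ ≡ 1
⟦⟧-T {true} _ = refl

module _ {A : Set} where

  ∑ : List A → (A → ℕ) → ℕ
  ∑ xs f = sum (map f xs)

  syntax ∑ xs (λ x → e) = ∑[ x ← xs ] e

  ∑-cong : ∀ xs {f g : A → ℕ} → (∀ x → f x ≡ g x) → ∑ xs f ≡ ∑ xs g
  ∑-cong xs f≗g = cong sum (map-cong f≗g xs)

  ∑-zero : ∀ xs → ∑[ x ← xs ] 0 ≡ 0
  ∑-zero []       = refl
  ∑-zero (x ∷ xs) = ∑-zero xs

  ∑-+ : ∀ xs (f g : A → ℕ) → ∑[ x ← xs ] (f x + g x) ≡ ∑ xs f + ∑ xs g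
  ∑-+ []       f g = refl
  ∑-+ (x ∷ xs) f g = trans (cong (f x + g x +_) (∑-+ xs f g)) (+-CS.interchange (f x) (g x) _ _)

  ∑-*ˡ : ∀ xs k (f : A → ℕ) → ∑[ x ← xs ] (k * f x) ≡ k * ∑ xs f
  ∑-*ˡ []       k f = sym (*-zeroʳ k)
  ∑-*ˡ (x ∷ xs) k f = trans (cong (k * f x +_) (∑-*ˡ xs k f)) (sym (*-distribˡ-+ k (f x) (∑ xs f)))

  ∑-*ʳ : ∀ xs k (f : A → ℕ) → ∑[ x ← xs ] (f x * k) ≡ ∑ xs f * k
  ∑-*ʳ xs k f = trans (∑-cong xs (λ x → *-comm (f x) k)) (trans (∑-*ˡ xs k f) (*-comm k (∑ xs f)))

  ∑-⟦∧⟧ : ∀ xs b (f : A → Bool) → ∑[ x ← xs ] ⟦ b ∧ f x ⟧ ≡ ⟦ b ⟧ * ∑[ x ← xs ] ⟦ f x ⟧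
  ∑-⟦∧⟧ xs b f = trans (∑-cong xs (λ x → ⟦∧⟧ b (f x))) (∑-*ˡ xs ⟦ b ⟧ (λ x → ⟦ f x ⟧))

  ∑-⟦∧⟧-inner : ∀ xs b (e f : A → Bool) →
                ⟦ b ⟧ * ∑[ x ← xs ] ⟦ e x ∧ f x ⟧ ≡ ∑[ x ← xs ] ⟦ e x ∧ (b ∧ f x) ⟧
  ∑-⟦∧⟧-inner xs b e f = trans (sym (∑-⟦∧⟧ xs b (λ x → e x ∧ f x)))
                               (∑-cong xs λ x → cong ⟦_⟧ (∧-CS.x∙yz≈y∙xz b (e x) (f x)))

  ∑-++ : ∀ xs ys (f : A → ℕ) → ∑ (xs ++ ys) f ≡ ∑ xs f + ∑ ys f
  ∑-++ xs ys f = trans (cong sum (map-++ f xs ys)) (sum-++ (map f xs) (map f ys))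

  length-filter≡∑ : ∀ {P : A → Set} (P? : ∀ x → Dec (P x)) xs →
                    length (filter P? xs) ≡ ∑[ x ← xs ] ⟦ does (P? x) ⟧
  length-filter≡∑ P? []       = refl
  length-filter≡∑ P? (x ∷ xs) with does (P? x)
  ... | true  = cong suc (length-filter≡∑ P? xs)
  ... | false = length-filter≡∑ P? xs

module _ {A B : Set} where

  ∑-map : ∀ xs (h : A → B) (f : B → ℕ) → ∑ (map h xs) f ≡ ∑[ x ← xs ] f (h x)
  ∑-map xs h f = cong sum (sym (map-∘ xs))

  ∑-concatMap : ∀ xs (h : A → List B) (f : B → ℕ) →
                ∑ (concatMap h xs) f ≡ ∑[ x ← xs ] ∑ (h x) f
  ∑-concatMap []       h f = refl
  ∑-concatMap (x ∷ xs) h f =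
    trans (∑-++ (h x) (concatMap h xs) f) (cong (∑ (h x) f +_) (∑-concatMap xs h f))

  ∑-comm : ∀ xs ys (f : A → B → ℕ) →
           ∑[ x ← xs ] ∑[ y ← ys ] f x y ≡ ∑[ y ← ys ] ∑[ x ← xs ] f x y
  ∑-comm []       ys f = sym (∑-zero ys)
  ∑-comm (x ∷ xs) ys f =
    trans (cong (∑ ys (f x) +_) (∑-comm xs ys f)) (sym (∑-+ ys (f x) (λ y → ∑[ x ← xs ] f x y)))

∑-allFin-suc : ∀ m (f : Fin (suc m) → ℕ) → ∑[ j ← allFin (suc m) ] f j ≡ f zero + ∑[ j ← allFin m ] f (suc j)
∑-allFin-suc m f = cong (λ js → f zero + sum js) (trans (map-tabulate suc f) (sym (map-tabulate id (f ∘ suc))))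

module _ {A : Set} (xs : List A) where

  ∑-allVecs-suc : ∀ m (g : Vec A (suc m) → ℕ) →
                  ∑ (allVecs xs (suc m)) g ≡ ∑[ x ← xs ] ∑[ v ← allVecs xs m ] g (x ∷ v)
  ∑-allVecs-suc m g = trans (∑-concatMap xs (λ x → map (x ∷_) (allVecs xs m)) g)
                            (∑-cong xs (λ x → ∑-map (allVecs xs m) (x ∷_) g))

  ∑-allVecs-∷ʳ : ∀ m (g : Vec A (suc m) → ℕ) →
                 ∑ (allVecs xs (suc m)) g ≡ ∑[ v ← allVecs xs m ] ∑[ x ← xs ] g (v ∷ʳ x)
  ∑-allVecs-∷ʳ zero    g =
    trans (∑-allVecs-suc zero g) (trans (∑-cong xs (λ x → +-identityʳ _)) (sym (+-identityʳ _)))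
  ∑-allVecs-∷ʳ (suc m) g = begin
    ∑ (allVecs xs (suc (suc m))) g
      ≡⟨ ∑-allVecs-suc (suc m) g ⟩
    ∑[ y ← xs ] ∑[ v ← allVecs xs (suc m) ] g (y ∷ v)
      ≡⟨ ∑-cong xs (λ y → ∑-allVecs-∷ʳ m (λ v → g (y ∷ v))) ⟩
    ∑[ y ← xs ] ∑[ v ← allVecs xs m ] ∑[ x ← xs ] g (y ∷ (v ∷ʳ x))
      ≡⟨ ∑-allVecs-suc m (λ v → ∑[ x ← xs ] g (v ∷ʳ x)) ⟨
    ∑[ v ← allVecs xs (suc m) ] ∑[ x ← xs ] g (v ∷ʳ x) ∎
    where open ≡-Reasoning

∑-allVecs-singleton : {A : Set} (x : A) (m : ℕ) (g : Vec A m → ℕ) → ∑ (allVecs (x ∷ []) m) g ≡ g (replicate m x)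
∑-allVecs-singleton x zero    g = +-identityʳ _
∑-allVecs-singleton x (suc m) g =
  trans (∑-allVecs-suc (x ∷ []) m g) (trans (+-identityʳ _) (∑-allVecs-singleton x m (g ∘ (x ∷_))))

bools : List Bool
bools = true ∷ false ∷ []

∑-allVecs-bools : ∀ m (g : Vec Bool (suc m) → ℕ) →
  ∑ (allVecs bools (suc m)) g ≡ ∑[ c ← allVecs bools m ] g (true ∷ c) + ∑[ c ← allVecs bools m ] g (false ∷ c)
∑-allVecs-bools m g =
  trans (∑-allVecs-suc bools m g) (cong (∑[ c ← allVecs bools m ] g (true ∷ c) +_) (+-identityʳ _))

-- The column c records which sets contain the new largest element.
∑-allVecs-allSubsets-suc : ∀ n m (g : Vec (Subset (suc n)) m → ℕ) →
  ∑ (allVecs (allSubsets (suc n)) m) g ≡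
  ∑[ F ← allVecs (allSubsets n) m ] ∑[ c ← allVecs bools m ] g (zipWith _∷ʳ_ F c)
∑-allVecs-allSubsets-suc n zero    g = sym (+-identityʳ _)
∑-allVecs-allSubsets-suc n (suc m) g = begin
  ∑ (allVecs (allSubsets (suc n)) (suc m)) g
    ≡⟨ ∑-allVecs-suc (allSubsets (suc n)) m g ⟩
  ∑[ S ← allSubsets (suc n) ] ∑[ F ← allVecs (allSubsets (suc n)) m ] g (S ∷ F)
    ≡⟨ ∑-cong (allSubsets (suc n)) (λ S → ∑-allVecs-allSubsets-suc n m (g ∘ (S ∷_))) ⟩
  ∑[ S ← allSubsets (suc n) ] h S
    ≡⟨ ∑-allVecs-∷ʳ bools n h ⟩
  ∑[ S ← allSubsets n ] ∑[ b ← bools ] ∑[ F ← allVecs (allSubsets n) m ] ∑[ c ← allVecs bools m ]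
    g ((S ∷ʳ b) ∷ zipWith _∷ʳ_ F c)
    ≡⟨ ∑-cong (allSubsets n) (λ S → ∑-comm bools (allVecs (allSubsets n) m)
         (λ b F → ∑[ c ← allVecs bools m ] g ((S ∷ʳ b) ∷ zipWith _∷ʳ_ F c))) ⟩
  ∑[ S ← allSubsets n ] ∑[ F ← allVecs (allSubsets n) m ] ∑[ b ← bools ] ∑[ c ← allVecs bools m ]
    g (zipWith _∷ʳ_ (S ∷ F) (b ∷ c))
    ≡⟨ ∑-cong (allSubsets n) (λ S → ∑-cong (allVecs (allSubsets n) m) (λ F →
         ∑-allVecs-suc bools m (g ∘ zipWith _∷ʳ_ (S ∷ F)))) ⟨
  ∑[ S ← allSubsets n ] ∑[ F ← allVecs (allSubsets n) m ] ∑[ c ← allVecs bools (suc m) ]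
    g (zipWith _∷ʳ_ (S ∷ F) c)
    ≡⟨ ∑-allVecs-suc (allSubsets n) m _ ⟨
  ∑[ F ← allVecs (allSubsets n) (suc m) ] ∑[ c ← allVecs bools (suc m) ] g (zipWith _∷ʳ_ F c) ∎
  where
  open ≡-Reasoning
  h : Subset (suc n) → ℕ
  h S = ∑[ F ← allVecs (allSubsets n) m ] ∑[ c ← allVecs bools m ] g (S ∷ zipWith _∷ʳ_ F c)

infix 4 _≟ₛ_
_≟ₛ_ : ∀ {n} → DecidableEquality (Subset n)
_≟ₛ_ = ≡-dec Bool._≟_

≟ₛ⊥-∷ʳ : ∀ {n} (S : Subset n) b → does ((S ∷ʳ b) ≟ₛ ⊥) ≡ does (S ≟ₛ ⊥) ∧ not b
≟ₛ⊥-∷ʳ []          true  = refl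
≟ₛ⊥-∷ʳ []          false = refl
≟ₛ⊥-∷ʳ (true ∷ S)  b     = refl
≟ₛ⊥-∷ʳ (false ∷ S) b     = ≟ₛ⊥-∷ʳ S b

≟ₛ⊤-∷ʳ : ∀ {n} (S : Subset n) b → does ((S ∷ʳ b) ≟ₛ ⊤) ≡ does (S ≟ₛ ⊤) ∧ b
≟ₛ⊤-∷ʳ []          true  = refl
≟ₛ⊤-∷ʳ []          false = refl
≟ₛ⊤-∷ʳ (true ∷ S)  b     = ≟ₛ⊤-∷ʳ S b
≟ₛ⊤-∷ʳ (false ∷ S) b     = refl

⊆?-∷ʳ : ∀ {n} (X Y : Subset n) x y → does ((X ∷ʳ x) ⊆? (Y ∷ʳ y)) ≡ does (X ⊆? Y) ∧ (not x ∨ y)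
⊆?-∷ʳ []          []          false y     = refl
⊆?-∷ʳ []          []          true  false = refl
⊆?-∷ʳ []          []          true  true  = refl
⊆?-∷ʳ (false ∷ X) (_ ∷ Y)     x     y     = ⊆?-∷ʳ X Y x y
⊆?-∷ʳ (true ∷ X)  (false ∷ Y) x     y     = refl
⊆?-∷ʳ (true ∷ X)  (true ∷ Y)  x     y     = ⊆?-∷ʳ X Y x y

∣∷─∷∣ : ∀ {n} (X Y : Subset n) x y → ∣ (y ∷ Y) ─ (x ∷ X) ∣ ≡ ⟦ y ∧ not x ⟧ + ∣ Y ─ X ∣
∣∷─∷∣ X Y false false = refl
∣∷─∷∣ X Y false true  = refl
∣∷─∷∣ X Y true  false = refl
∣∷─∷∣ X Y true  true  = refl

∣∷ʳ─∷ʳ∣ : ∀ {n} (X Y : Subset n) x y → ∣ (Y ∷ʳ y) ─ (X ∷ʳ x) ∣ ≡ ⟦ y ∧ not x ⟧ + ∣ Y ─ X ∣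
∣∷ʳ─∷ʳ∣ []       []       x y = ∣∷─∷∣ [] [] x y
∣∷ʳ─∷ʳ∣ (x₀ ∷ X) (y₀ ∷ Y) x y = begin
  ∣ (y₀ ∷ (Y ∷ʳ y)) ─ (x₀ ∷ (X ∷ʳ x)) ∣  ≡⟨ ∣∷─∷∣ (X ∷ʳ x) (Y ∷ʳ y) x₀ y₀ ⟩
  new₀ + ∣ (Y ∷ʳ y) ─ (X ∷ʳ x) ∣         ≡⟨ cong (new₀ +_) (∣∷ʳ─∷ʳ∣ X Y x y) ⟩
  new₀ + (new + ∣ Y ─ X ∣)               ≡⟨ +-CS.x∙yz≈y∙xz new₀ new ∣ Y ─ X ∣ ⟩
  new + (new₀ + ∣ Y ─ X ∣)               ≡⟨ cong (new +_) (∣∷─∷∣ X Y x₀ y₀) ⟨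
  new + ∣ (y₀ ∷ Y) ─ (x₀ ∷ X) ∣          ∎
  where
  open ≡-Reasoning
  new₀ = ⟦ y₀ ∧ not x₀ ⟧
  new  = ⟦ y ∧ not x ⟧

MaxNotIn : ∀ {n} → Subset n → Subset n → Set
MaxNotIn {n} X Y = (x : Fin n) → x ∈ Y → ((y : Fin n) → y ∈ Y → toℕ y ≤ toℕ x) → x ∉ X

-- Index 0 is the smallest element, so the maximum of y ∷ Y is its head exactly when Y is empty.
maxNotInᵇ : ∀ {n} → Subset n → Subset n → Bool
maxNotInᵇ []      []      = true
maxNotInᵇ (x ∷ X) (y ∷ Y) = if does (Y ≟ₛ ⊥) then not (y ∧ x) else maxNotInᵇ X Y

maxNotInᵇ-∷ʳ : ∀ {n} (X Y : Subset n) x y →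
               maxNotInᵇ (X ∷ʳ x) (Y ∷ʳ y) ≡ (if y then not x else maxNotInᵇ X Y)
maxNotInᵇ-∷ʳ []       []       x true  = refl
maxNotInᵇ-∷ʳ []       []       x false = refl
maxNotInᵇ-∷ʳ (x₀ ∷ X) (y₀ ∷ Y) x y
  rewrite ≟ₛ⊥-∷ʳ Y y | maxNotInᵇ-∷ʳ X Y x y with does (Y ≟ₛ ⊥) | y
... | true  | true  = refl
... | true  | false = refl
... | false | true  = refl
... | false | false = refl

module _ {n : ℕ} {b : Bool} {Y : Subset n} where

  max-there : ∀ {m : Fin n} → (∀ y → y ∈ Y → toℕ y ≤ toℕ m) →
              ∀ y → y ∈ b ∷ Y → toℕ y ≤ toℕ (suc m)
  max-there m-max zero    _         = z≤n
  max-there m-max (suc y) (there y∈) = s≤s (m-max y y∈)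

  max-there⁻ : ∀ {m : Fin n} → (∀ y → y ∈ b ∷ Y → toℕ y ≤ toℕ (suc m)) →
               ∀ y → y ∈ Y → toℕ y ≤ toℕ m
  max-there⁻ m-max y y∈ = ≤-pred (m-max (suc y) (there y∈))

maxNotInᵇ-sound : ∀ {n} (X Y : Subset n) → T (maxNotInᵇ X Y) → MaxNotIn X Y
maxNotInᵇ-sound (x₀ ∷ X) (y₀ ∷ Y) h m m∈Y m-max m∈X with Y ≟ₛ ⊥
maxNotInᵇ-sound (true ∷ X) (true ∷ Y) h zero    here        m-max here        | yes refl = h
maxNotInᵇ-sound (x₀ ∷ X)   (y₀ ∷ Y)   h (suc m) (there m∈Y) m-max m∈X         | yes refl = ∉⊥ m∈Y
maxNotInᵇ-sound (x₀ ∷ X)   (y₀ ∷ Y)   h zero    m∈Y         m-max m∈X         | no Y≢⊥ =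
  Y≢⊥ (Empty-unique λ { (y , y∈Y) → case m-max (suc y) (there y∈Y) of λ () })
maxNotInᵇ-sound (x₀ ∷ X)   (y₀ ∷ Y)   h (suc m) (there m∈Y) m-max (there m∈X) | no Y≢⊥ =
  maxNotInᵇ-sound X Y h m m∈Y (max-there⁻ m-max) m∈X

maxNotInᵇ-complete : ∀ {n} (X Y : Subset n) → MaxNotIn X Y → T (maxNotInᵇ X Y)
maxNotInᵇ-complete []       []       h = _
maxNotInᵇ-complete (x₀ ∷ X) (y₀ ∷ Y) h with Y ≟ₛ ⊥
maxNotInᵇ-complete (true ∷ X)  (true ∷ Y)  h | yes refl = h zero here zero-max here
  where
  zero-max : ∀ y → y ∈ true ∷ ⊥ → toℕ y ≤ 0
  zero-max zero    _          = z≤n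
  zero-max (suc y) (there y∈) = contradiction y∈ ∉⊥
maxNotInᵇ-complete (false ∷ X) (true ∷ Y)  h | yes refl = _
maxNotInᵇ-complete (x₀ ∷ X)    (false ∷ Y) h | yes refl = _
... | no _ = maxNotInᵇ-complete X Y λ m m∈Y m-max m∈X → h (suc m) (there m∈Y) (max-there m-max) (there m∈X)

maxNotIn? : ∀ {n} (X Y : Subset n) → Dec (MaxNotIn X Y)
maxNotIn? X Y = maxNotInᵇ X Y because fromEquivalence (maxNotInᵇ-sound X Y) (maxNotInᵇ-complete X Y)

-- Marked types and their flags

-- Step i is (aᵢ , ρᵢ): it adds aᵢ elements and, if ρᵢ, is subject to the restriction.
MarkedType : Set
MarkedType = List (ℕ × Bool)

Step : ∀ {n} → ℕ × Bool → Subset n → Subset n → Set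
Step (a , ρ) X Y = X ⊆ Y × (T ρ → MaxNotIn X Y) × ∣ Y ─ X ∣ ≡ a

step? : ∀ {n} s (X Y : Subset n) → Dec (Step s X Y)
step? (a , ρ) X Y = X ⊆? Y ×-dec (T? ρ →-dec maxNotIn? X Y) ×-dec ∣ Y ─ X ∣ ≟ a

module _ {n : ℕ} (X Y : Subset n) where

  step?-outside-outside : ∀ s → does (step? s (X ∷ʳ false) (Y ∷ʳ false)) ≡ does (step? s X Y)
  step?-outside-outside (a , ρ)
    rewrite ⊆?-∷ʳ X Y false false | maxNotInᵇ-∷ʳ X Y false false | ∣∷ʳ─∷ʳ∣ X Y false false
          | ∧-identityʳ (does (X ⊆? Y)) = refl

  step?-outside-inside : ∀ a ρ →
    does (step? (a , ρ) (X ∷ʳ false) (Y ∷ʳ true)) ≡ (0 <ᵇ a) ∧ does (step? (a ∸ 1 , false) X Y)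
  step?-outside-inside a ρ
    rewrite ⊆?-∷ʳ X Y false true | maxNotInᵇ-∷ʳ X Y false true | ∣∷ʳ─∷ʳ∣ X Y false true
          | ∧-identityʳ (does (X ⊆? Y)) | ∨-zeroʳ (not ρ) with a
  ... | zero  = ∧-zeroʳ (does (X ⊆? Y))
  ... | suc _ = refl

  step?-inside-inside : ∀ a ρ →
    does (step? (a , ρ) (X ∷ʳ true) (Y ∷ʳ true)) ≡ not ρ ∧ does (step? (a , ρ) X Y)
  step?-inside-inside a ρ
    rewrite ⊆?-∷ʳ X Y true true | maxNotInᵇ-∷ʳ X Y true true | ∣∷ʳ─∷ʳ∣ X Y true true
          | ∧-identityʳ (does (X ⊆? Y)) | ∨-identityʳ (not ρ) with ρ
  ... | true  = ∧-zeroʳ (does (X ⊆? Y))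
  ... | false = refl

  step?-inside-outside : ∀ s → does (step? s (X ∷ʳ true) (Y ∷ʳ false)) ≡ false
  step?-inside-outside (a , ρ) rewrite ⊆?-∷ʳ X Y true false | ∧-zeroʳ (does (X ⊆? Y)) = refl

Chain : ∀ {n r} → MarkedType → Vec (Subset n) (suc r) → Set
Chain []       (S ∷ [])     = S ≡ ⊤
Chain []       (_ ∷ _ ∷ _)  = Empty.⊥
Chain (_ ∷ _)  (_ ∷ [])     = Empty.⊥
Chain (s ∷ ts) (S ∷ S' ∷ F) = Step s S S' × Chain ts (S' ∷ F)

chain? : ∀ {n r} ts (F : Vec (Subset n) (suc r)) → Dec (Chain ts F)
chain? []       (S ∷ [])     = S ≟ₛ ⊤
chain? []       (_ ∷ _ ∷ _)  = no λ ()
chain? (_ ∷ _)  (_ ∷ [])     = no λ ()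
chain? (s ∷ ts) (S ∷ S' ∷ F) = step? s S S' ×-dec chain? ts (S' ∷ F)

MarkedFlag : ∀ {n r} → MarkedType → Vec (Subset n) (suc r) → Set
MarkedFlag ts F = head F ≡ ⊥ × Chain ts F

markedFlag? : ∀ {n r} ts (F : Vec (Subset n) (suc r)) → Dec (MarkedFlag ts F)
markedFlag? ts F = head F ≟ₛ ⊥ ×-dec chain? ts F

count : ℕ → ℕ → MarkedType → ℕ
count n r ts = ∑[ F ← allFlags n r ] ⟦ does (markedFlag? ts F) ⟧

-- Deleting the largest element

allUnmarked : MarkedType → Bool
allUnmarked []            = true
allUnmarked ((_ , ρ) ∷ ts) = not ρ ∧ allUnmarked ts

-- The steps at which the largest element can enter a flag of marked type ts, and the
-- marked type of what remains once it is deleted.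
canEnterAt : (ts : MarkedType) → Fin (length ts) → Bool
canEnterAt ((a , _) ∷ ts) zero    = (0 <ᵇ a) ∧ allUnmarked ts
canEnterAt (_ ∷ ts)       (suc j) = canEnterAt ts j

shrinkAt : (ts : MarkedType) → Fin (length ts) → MarkedType
shrinkAt ((a , _) ∷ ts) zero    = (a ∸ 1 , false) ∷ ts
shrinkAt (s ∷ ts)       (suc j) = s ∷ shrinkAt ts j

∑-column-inside : ∀ {n r} ts (F : Vec (Subset n) (suc r)) →
  ∑[ c ← allVecs bools r ] ⟦ does (chain? ts (zipWith _∷ʳ_ F (true ∷ c))) ⟧ ≡
  ⟦ allUnmarked ts ∧ does (chain? ts F) ⟧
∑-column-inside             []             (S ∷ [])     =
  trans (+-identityʳ _) (cong ⟦_⟧ (trans (≟ₛ⊤-∷ʳ S true) (∧-identityʳ _)))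
∑-column-inside {r = suc r} []             (_ ∷ _ ∷ _)  =
  trans (∑-cong (allVecs bools (suc r)) λ { (_ ∷ _) → refl }) (∑-zero (allVecs bools (suc r)))
∑-column-inside             (_ ∷ ts)       (_ ∷ [])     = cong ⟦_⟧ (sym (∧-zeroʳ _))
∑-column-inside {r = suc r} ((a , ρ) ∷ ts) (S ∷ S' ∷ F) = begin
  ∑[ c ← allVecs bools (suc r) ] ⟦ does (chain? ((a , ρ) ∷ ts) (zipWith _∷ʳ_ (S ∷ S' ∷ F) (true ∷ c))) ⟧
    ≡⟨ ∑-allVecs-bools r _ ⟩
  ∑[ c ← allVecs bools r ] ⟦ does (step? (a , ρ) (S ∷ʳ true) (S' ∷ʳ true)) ∧ rest true c ⟧
    + ∑[ c ← allVecs bools r ] ⟦ does (step? (a , ρ) (S ∷ʳ true) (S' ∷ʳ false)) ∧ rest false c ⟧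
    ≡⟨ cong₂ _+_ (∑-⟦∧⟧ (allVecs bools r) _ (rest true)) (∑-⟦∧⟧ (allVecs bools r) _ (rest false)) ⟩
  ⟦ does (step? (a , ρ) (S ∷ʳ true) (S' ∷ʳ true)) ⟧ * R true
    + ⟦ does (step? (a , ρ) (S ∷ʳ true) (S' ∷ʳ false)) ⟧ * R false
    ≡⟨ cong₂ (λ x y → ⟦ x ⟧ * R true + ⟦ y ⟧ * R false)
             (step?-inside-inside S S' a ρ) (step?-inside-outside S S' (a , ρ)) ⟩
  ⟦ not ρ ∧ st ⟧ * R true + 0
    ≡⟨ +-identityʳ _ ⟩
  ⟦ not ρ ∧ st ⟧ * R true
    ≡⟨ cong (⟦ not ρ ∧ st ⟧ *_) (∑-column-inside ts (S' ∷ F)) ⟩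
  ⟦ not ρ ∧ st ⟧ * ⟦ allUnmarked ts ∧ does (chain? ts (S' ∷ F)) ⟧
    ≡⟨ ⟦∧⟧-interchange (not ρ) st (allUnmarked ts) (does (chain? ts (S' ∷ F))) ⟩
  ⟦ allUnmarked ((a , ρ) ∷ ts) ∧ does (chain? ((a , ρ) ∷ ts) (S ∷ S' ∷ F)) ⟧ ∎
  where
  open ≡-Reasoning
  st : Bool
  st = does (step? (a , ρ) S S')
  rest : Bool → Vec Bool r → Bool
  rest b c = does (chain? ts (zipWith _∷ʳ_ (S' ∷ F) (b ∷ c)))
  R : Bool → ℕ
  R b = ∑[ c ← allVecs bools r ] ⟦ rest b c ⟧

∑-column-outside : ∀ {n r} ts (F : Vec (Subset n) (suc r)) →
  ∑[ c ← allVecs bools r ] ⟦ does (chain? ts (zipWith _∷ʳ_ F (false ∷ c))) ⟧ ≡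
  ∑[ j ← allFin (length ts) ] ⟦ canEnterAt ts j ∧ does (chain? (shrinkAt ts j) F) ⟧
∑-column-outside             []             (S ∷ [])     =
  trans (+-identityʳ _) (cong ⟦_⟧ (trans (≟ₛ⊤-∷ʳ S false) (∧-zeroʳ _)))
∑-column-outside {r = suc r} []             (_ ∷ _ ∷ _)  =
  trans (∑-cong (allVecs bools (suc r)) λ { (_ ∷ _) → refl }) (∑-zero (allVecs bools (suc r)))
∑-column-outside             ((a , ρ) ∷ ts) (S ∷ [])     =
  sym (trans (∑-cong (allFin (suc (length ts))) {g = λ _ → 0} λ
                { zero → cong ⟦_⟧ (∧-zeroʳ _) ; (suc j) → cong ⟦_⟧ (∧-zeroʳ _) })
             (∑-zero (allFin (suc (length ts)))))
∑-column-outside {r = suc r} ((a , ρ) ∷ ts) (S ∷ S' ∷ F) = begin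
  ∑[ c ← allVecs bools (suc r) ] ⟦ does (chain? ((a , ρ) ∷ ts) (zipWith _∷ʳ_ (S ∷ S' ∷ F) (false ∷ c))) ⟧
    ≡⟨ ∑-allVecs-bools r _ ⟩
  ∑[ c ← allVecs bools r ] ⟦ does (step? (a , ρ) (S ∷ʳ false) (S' ∷ʳ true)) ∧ rest true c ⟧
    + ∑[ c ← allVecs bools r ] ⟦ does (step? (a , ρ) (S ∷ʳ false) (S' ∷ʳ false)) ∧ rest false c ⟧
    ≡⟨ cong₂ _+_ (∑-⟦∧⟧ (allVecs bools r) _ (rest true)) (∑-⟦∧⟧ (allVecs bools r) _ (rest false)) ⟩
  ⟦ does (step? (a , ρ) (S ∷ʳ false) (S' ∷ʳ true)) ⟧ * R true
    + ⟦ does (step? (a , ρ) (S ∷ʳ false) (S' ∷ʳ false)) ⟧ * R false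
    ≡⟨ cong₂ (λ x y → ⟦ x ⟧ * R true + ⟦ y ⟧ * R false)
             (step?-outside-inside S S' a ρ) (step?-outside-outside S S' (a , ρ)) ⟩
  ⟦ (0 <ᵇ a) ∧ st⁻ ⟧ * R true + ⟦ st ⟧ * R false
    ≡⟨ cong₂ (λ x y → ⟦ (0 <ᵇ a) ∧ st⁻ ⟧ * x + ⟦ st ⟧ * y)
             (∑-column-inside ts (S' ∷ F)) (∑-column-outside ts (S' ∷ F)) ⟩
  ⟦ (0 <ᵇ a) ∧ st⁻ ⟧ * ⟦ allUnmarked ts ∧ ch ⟧
    + ⟦ st ⟧ * ∑[ j ← allFin (length ts) ] ⟦ canEnterAt ts j ∧ chₛ j ⟧
    ≡⟨ cong₂ _+_ (⟦∧⟧-interchange (0 <ᵇ a) st⁻ (allUnmarked ts) ch)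
                 (∑-⟦∧⟧-inner (allFin (length ts)) st (canEnterAt ts) chₛ) ⟩
  ⟦ ((0 <ᵇ a) ∧ allUnmarked ts) ∧ (st⁻ ∧ ch) ⟧
    + ∑[ j ← allFin (length ts) ] ⟦ canEnterAt ts j ∧ (st ∧ chₛ j) ⟧
    ≡⟨ ∑-allFin-suc (length ts) _ ⟨
  ∑[ j ← allFin (suc (length ts)) ]
    ⟦ canEnterAt ((a , ρ) ∷ ts) j ∧ does (chain? (shrinkAt ((a , ρ) ∷ ts) j) (S ∷ S' ∷ F)) ⟧ ∎
  where
  open ≡-Reasoning
  st st⁻ ch : Bool
  st  = does (step? (a , ρ) S S')
  st⁻ = does (step? (a ∸ 1 , false) S S')
  ch  = does (chain? ts (S' ∷ F))
  chₛ : Fin (length ts) → Bool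
  chₛ j = does (chain? (shrinkAt ts j) (S' ∷ F))
  rest : Bool → Vec Bool r → Bool
  rest b c = does (chain? ts (zipWith _∷ʳ_ (S' ∷ F) (b ∷ c)))
  R : Bool → ℕ
  R b = ∑[ c ← allVecs bools r ] ⟦ rest b c ⟧

∑-column : ∀ {n r} ts (F : Vec (Subset n) (suc r)) →
  ∑[ c ← allVecs bools (suc r) ] ⟦ does (markedFlag? ts (zipWith _∷ʳ_ F c)) ⟧ ≡
  ∑[ j ← allFin (length ts) ] ⟦ canEnterAt ts j ∧ does (markedFlag? (shrinkAt ts j) F) ⟧
∑-column {r = r} ts (S ∷ F) = begin
  ∑[ c ← allVecs bools (suc r) ] ⟦ does (markedFlag? ts (zipWith _∷ʳ_ (S ∷ F) c)) ⟧
    ≡⟨ ∑-allVecs-bools r _ ⟩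
  ∑[ c ← allVecs bools r ] ⟦ does ((S ∷ʳ true) ≟ₛ ⊥) ∧ rest true c ⟧
    + ∑[ c ← allVecs bools r ] ⟦ does ((S ∷ʳ false) ≟ₛ ⊥) ∧ rest false c ⟧
    ≡⟨ cong₂ _+_ (∑-⟦∧⟧ (allVecs bools r) _ (rest true)) (∑-⟦∧⟧ (allVecs bools r) _ (rest false)) ⟩
  ⟦ does ((S ∷ʳ true) ≟ₛ ⊥) ⟧ * R true + ⟦ does ((S ∷ʳ false) ≟ₛ ⊥) ⟧ * R false
    ≡⟨ cong₂ (λ x y → ⟦ x ⟧ * R true + ⟦ y ⟧ * R false)
             (trans (≟ₛ⊥-∷ʳ S true) (∧-zeroʳ _)) (trans (≟ₛ⊥-∷ʳ S false) (∧-identityʳ _)) ⟩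
  ⟦ empty ⟧ * R false
    ≡⟨ cong (⟦ empty ⟧ *_) (∑-column-outside ts (S ∷ F)) ⟩
  ⟦ empty ⟧ * ∑[ j ← allFin (length ts) ] ⟦ canEnterAt ts j ∧ does (chain? (shrinkAt ts j) (S ∷ F)) ⟧
    ≡⟨ ∑-⟦∧⟧-inner (allFin (length ts)) empty (canEnterAt ts) _ ⟩
  ∑[ j ← allFin (length ts) ] ⟦ canEnterAt ts j ∧ does (markedFlag? (shrinkAt ts j) (S ∷ F)) ⟧ ∎
  where
  open ≡-Reasoning
  empty : Bool
  empty = does (S ≟ₛ ⊥)
  rest : Bool → Vec Bool r → Bool
  rest b c = does (chain? ts (zipWith _∷ʳ_ (S ∷ F) (b ∷ c)))
  R : Bool → ℕ
  R b = ∑[ c ← allVecs bools r ] ⟦ rest b c ⟧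

count-suc : ∀ n r ts →
  count (suc n) r ts ≡ ∑[ j ← allFin (length ts) ] (⟦ canEnterAt ts j ⟧ * count n r (shrinkAt ts j))
count-suc n r ts = begin
  count (suc n) r ts
    ≡⟨ ∑-allVecs-allSubsets-suc n (suc r) _ ⟩
  ∑[ F ← allFlags n r ] ∑[ c ← allVecs bools (suc r) ] ⟦ does (markedFlag? ts (zipWith _∷ʳ_ F c)) ⟧
    ≡⟨ ∑-cong (allFlags n r) (∑-column ts) ⟩
  ∑[ F ← allFlags n r ] ∑[ j ← allFin (length ts) ] ⟦ canEnterAt ts j ∧ does (markedFlag? (shrinkAt ts j) F) ⟧
    ≡⟨ ∑-comm (allFlags n r) (allFin (length ts)) _ ⟩
  ∑[ j ← allFin (length ts) ] ∑[ F ← allFlags n r ] ⟦ canEnterAt ts j ∧ does (markedFlag? (shrinkAt ts j) F) ⟧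
    ≡⟨ ∑-cong (allFin (length ts)) (λ j → ∑-⟦∧⟧ (allFlags n r) (canEnterAt ts j) _) ⟩
  ∑[ j ← allFin (length ts) ] (⟦ canEnterAt ts j ⟧ * count n r (shrinkAt ts j)) ∎
  where open ≡-Reasoning

-- The closed form

sizes : MarkedType → List ℕ
sizes = map proj₁

markedPrefixProduct : ℕ → MarkedType → ℕ
markedPrefixProduct s []             = 1
markedPrefixProduct s ((a , ρ) ∷ ts) = (if ρ then s + a else 1) * markedPrefixProduct (s + a) ts

denominator : MarkedType → ℕ
denominator ts = markedPrefixProduct 0 ts * factProd (sizes ts)

markedSizeProduct : MarkedType → ℕ
markedSizeProduct []             = 1
markedSizeProduct ((a , ρ) ∷ ts) = (if ρ then a else 1) * markedSizeProduct ts

entryWeight : ℕ → (ts : MarkedType) → Fin (length ts) → ℕ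
entryWeight s ((a , ρ) ∷ ts) zero    = if ρ then s + a else a
entryWeight s ((a , _) ∷ ts) (suc j) = entryWeight (s + a) ts j

markedPrefixProduct-allUnmarked : ∀ s ts → T (allUnmarked ts) → markedPrefixProduct s ts ≡ 1
markedPrefixProduct-allUnmarked s []                 _ = refl
markedPrefixProduct-allUnmarked s ((a , false) ∷ ts) u =
  trans (+-identityʳ _) (markedPrefixProduct-allUnmarked (s + a) ts u)

markedSizeProduct-allUnmarked : ∀ ts → T (allUnmarked ts) → markedSizeProduct ts ≡ 1
markedSizeProduct-allUnmarked []                 _ = refl
markedSizeProduct-allUnmarked ((a , false) ∷ ts) u = trans (+-identityʳ _) (markedSizeProduct-allUnmarked ts u)

length-shrinkAt : ∀ ts j → length (shrinkAt ts j) ≡ length ts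
length-shrinkAt (_ ∷ ts) zero    = refl
length-shrinkAt (_ ∷ ts) (suc j) = cong suc (length-shrinkAt ts j)

sum-sizes-shrinkAt : ∀ ts j → T (canEnterAt ts j) → suc (sum (sizes (shrinkAt ts j))) ≡ sum (sizes ts)
sum-sizes-shrinkAt ((suc a , _) ∷ ts) zero    _ = refl
sum-sizes-shrinkAt ((a , _) ∷ ts)     (suc j) e =
  trans (sym (+-suc a _)) (cong (a +_) (sum-sizes-shrinkAt ts j e))

shrinkAt-factorisation : ∀ s ts j → T (canEnterAt ts j) → ∃[ q ]
  (markedPrefixProduct s ts * factProd (sizes ts)
     ≡ entryWeight s ts j * q * (markedPrefixProduct s (shrinkAt ts j) * factProd (sizes (shrinkAt ts j))))
  × (markedSizeProduct ts ≡ q * markedSizeProduct (shrinkAt ts j))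
shrinkAt-factorisation s ((suc a , ρ) ∷ ts) zero u
  rewrite markedPrefixProduct-allUnmarked (s + suc a) ts u | markedPrefixProduct-allUnmarked (s + a) ts u =
  q , prefixes ρ , cong (q *_) (sym (*-identityˡ _))
  where
  q = if ρ then suc a else 1
  prefixes : ∀ ρ → (if ρ then s + suc a else 1) * 1 * (factorial (suc a) * factProd (sizes ts))
                   ≡ (if ρ then s + suc a else suc a) * (if ρ then suc a else 1)
                     * (1 * 1 * (factorial a * factProd (sizes ts)))
  prefixes true  = reorder (s + suc a) (suc a) (factorial a) (factProd (sizes ts))
    where
    reorder : ∀ x y f g → x * 1 * (y * f * g) ≡ x * y * (1 * 1 * (f * g))
    reorder = solve-∀
  prefixes false = reorder (suc a) (factorial a) (factProd (sizes ts))
    where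
    reorder : ∀ y f g → 1 * 1 * (y * f * g) ≡ y * 1 * (1 * 1 * (f * g))
    reorder = solve-∀
shrinkAt-factorisation s ((a , ρ) ∷ ts) (suc j) e with shrinkAt-factorisation (s + a) ts j e
... | q , prefixes , marked = q , prefixes′ , marked′
  where
  open ≡-Reasoning
  g = if ρ then s + a else 1
  D = markedPrefixProduct (s + a) ts
  D′ = markedPrefixProduct (s + a) (shrinkAt ts j)
  F = factProd (sizes ts)
  F′ = factProd (sizes (shrinkAt ts j))
  w = entryWeight (s + a) ts j
  prefixes′ : g * D * (factorial a * F) ≡ w * q * (g * D′ * (factorial a * F′))
  prefixes′ = begin
    g * D * (factorial a * F)          ≡⟨ *-CS.interchange g D (factorial a) F ⟩
    g * factorial a * (D * F)          ≡⟨ cong (g * factorial a *_) prefixes ⟩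
    g * factorial a * (w * q * (D′ * F′)) ≡⟨ *-CS.x∙yz≈y∙xz (g * factorial a) (w * q) (D′ * F′) ⟩
    w * q * (g * factorial a * (D′ * F′)) ≡⟨ cong (w * q *_) (*-CS.interchange g (factorial a) D′ F′) ⟩
    w * q * (g * D′ * (factorial a * F′)) ∎
  marked′ : (if ρ then a else 1) * markedSizeProduct ts ≡ q * ((if ρ then a else 1) * markedSizeProduct (shrinkAt ts j))
  marked′ = trans (cong ((if ρ then a else 1) *_) marked) (*-CS.x∙yz≈y∙xz (if ρ then a else 1) q _)

-- The factor markedSizeProduct ts covers a marked step of size 0, where the weights fall short.
∑-entryWeight : ∀ s ts →
  markedSizeProduct ts * ∑[ j ← allFin (length ts) ] (⟦ canEnterAt ts j ⟧ * entryWeight s ts j)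
  ≡ markedSizeProduct ts * ((if allUnmarked ts then 0 else s) + sum (sizes ts))
∑-entryWeight s []             = refl
∑-entryWeight s ((a , ρ) ∷ ts) = begin
  g * N * ∑[ j ← allFin (suc (length ts)) ] (⟦ canEnterAt ((a , ρ) ∷ ts) j ⟧ * entryWeight s ((a , ρ) ∷ ts) j)
    ≡⟨ cong (g * N *_) (∑-allFin-suc (length ts) _) ⟩
  g * N * (⟦ (0 <ᵇ a) ∧ allUnmarked ts ⟧ * w + W)
    ≡⟨ distrib g N (⟦ (0 <ᵇ a) ∧ allUnmarked ts ⟧ * w) W ⟩
  g * (N * (⟦ (0 <ᵇ a) ∧ allUnmarked ts ⟧ * w)) + g * (N * W)
    ≡⟨ cong (λ x → g * (N * (⟦ (0 <ᵇ a) ∧ allUnmarked ts ⟧ * w)) + g * x) (∑-entryWeight (s + a) ts) ⟩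
  g * (N * (⟦ (0 <ᵇ a) ∧ allUnmarked ts ⟧ * w)) + g * (N * ((if allUnmarked ts then 0 else s + a) + t))
    ≡⟨ add-first-term a ρ (allUnmarked ts) N (markedSizeProduct-allUnmarked ts) ⟩
  g * N * ((if not ρ ∧ allUnmarked ts then 0 else s) + (a + t)) ∎
  where
  open ≡-Reasoning
  g = if ρ then a else 1
  w = if ρ then s + a else a
  N = markedSizeProduct ts
  t = sum (sizes ts)
  W = ∑[ j ← allFin (length ts) ] (⟦ canEnterAt ts j ⟧ * entryWeight (s + a) ts j)
  distrib : ∀ g N x y → g * N * (x + y) ≡ g * (N * x) + g * (N * y)
  distrib = solve-∀
  add-first-term : ∀ a ρ u N → (T u → N ≡ 1) →
    let g = if ρ then a else 1 in
    g * (N * (⟦ (0 <ᵇ a) ∧ u ⟧ * (if ρ then s + a else a))) + g * (N * ((if u then 0 else s + a) + t))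
    ≡ g * N * ((if not ρ ∧ u then 0 else s) + (a + t))
  add-first-term a ρ false N _ rewrite ∧-zeroʳ (0 <ᵇ a) | ∧-zeroʳ (not ρ) =
    reorder (if ρ then a else 1) N (if ρ then s + a else a) a s t
    where
    reorder : ∀ g N w a s t → g * (N * (0 * w)) + g * (N * (s + a + t)) ≡ g * N * (s + (a + t))
    reorder = solve-∀
  add-first-term a ρ true N N≡1 with N≡1 _
  add-first-term zero    true  true .1 _ | refl = refl
  add-first-term (suc a) true  true .1 _ | refl = reorder (suc a) s t
    where
    reorder : ∀ x s t → x * (1 * (1 * (s + x))) + x * (1 * (0 + t)) ≡ x * 1 * (s + (x + t))
    reorder = solve-∀
  add-first-term zero    false true .1 _ | refl = reorder t
    where
    reorder : ∀ t → 1 * (1 * (0 * 0)) + 1 * (1 * (0 + t)) ≡ 1 * 1 * (0 + (0 + t))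
    reorder = solve-∀
  add-first-term (suc a) false true .1 _ | refl = reorder (suc a) t
    where
    reorder : ∀ x t → 1 * (1 * (1 * x)) + 1 * (1 * (0 + t)) ≡ 1 * 1 * (0 + (x + t))
    reorder = solve-∀

chain?-empty : ∀ ts → sum (sizes ts) ≡ 0 → T (does (chain? ts (replicate (suc (length ts)) [])))
chain?-empty []                  _  = _
chain?-empty ((zero , true) ∷ ts)  t≡0 = chain?-empty ts t≡0
chain?-empty ((zero , false) ∷ ts) t≡0 = chain?-empty ts t≡0

count-zero : ∀ ts → sum (sizes ts) ≡ 0 → count 0 (length ts) ts ≡ 1
count-zero ts t≡0 = begin
  count 0 (length ts) ts                                   ≡⟨ ∑-allVecs-singleton [] (suc (length ts)) _ ⟩
  ⟦ does (chain? ts (replicate (suc (length ts)) [])) ⟧     ≡⟨ ⟦⟧-T (chain?-empty ts t≡0) ⟩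
  1                                                        ∎
  where open ≡-Reasoning

denominator-zero : ∀ ts → sum (sizes ts) ≡ 0 → denominator ts ≡ markedSizeProduct ts
denominator-zero []                    _   = refl
denominator-zero ((zero , true) ∷ ts)  _   = refl
denominator-zero ((zero , false) ∷ ts) t≡0 =
  trans (cong₂ _*_ (*-identityˡ (markedPrefixProduct 0 ts)) (*-identityˡ (factProd (sizes ts))))
        (trans (denominator-zero ts t≡0) (sym (*-identityˡ _)))

count-shrinkAt : ∀ n r ts j → T (canEnterAt ts j) →
  count n r (shrinkAt ts j) * denominator (shrinkAt ts j) ≡ factorial n * markedSizeProduct (shrinkAt ts j) →
  count n r (shrinkAt ts j) * denominator ts ≡ entryWeight 0 ts j * (factorial n * markedSizeProduct ts)
count-shrinkAt n r ts j e closedForm with shrinkAt-factorisation 0 ts j e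
... | q , D≡ , N≡ = begin
  c * denominator ts           ≡⟨ cong (c *_) D≡ ⟩
  c * (w * q * D′)             ≡⟨ *-CS.x∙yz≈y∙xz c (w * q) D′ ⟩
  w * q * (c * D′)             ≡⟨ cong (w * q *_) closedForm ⟩
  w * q * (factorial n * N′)   ≡⟨ *-assoc w q (factorial n * N′) ⟩
  w * (q * (factorial n * N′)) ≡⟨ cong (w *_) (*-CS.x∙yz≈y∙xz q (factorial n) N′) ⟩
  w * (factorial n * (q * N′)) ≡⟨ cong (λ x → w * (factorial n * x)) N≡ ⟨
  w * (factorial n * markedSizeProduct ts) ∎
  where
  open ≡-Reasoning
  c = count n r (shrinkAt ts j)
  w = entryWeight 0 ts j
  D′ = denominator (shrinkAt ts j)
  N′ = markedSizeProduct (shrinkAt ts j)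

count-closedForm : ∀ n r ts → length ts ≡ r → sum (sizes ts) ≡ n →
  count n r ts * denominator ts ≡ factorial n * markedSizeProduct ts
count-closedForm zero    r ts refl t≡0 =
  cong₂ _*_ (count-zero ts t≡0) (denominator-zero ts t≡0)
count-closedForm (suc n) r ts len tot = begin
  count (suc n) r ts * D
    ≡⟨ cong (_* D) (count-suc n r ts) ⟩
  ∑[ j ← allFin (length ts) ] (⟦ canEnterAt ts j ⟧ * count n r (shrinkAt ts j)) * D
    ≡⟨ ∑-*ʳ (allFin (length ts)) D _ ⟨
  ∑[ j ← allFin (length ts) ] (⟦ canEnterAt ts j ⟧ * count n r (shrinkAt ts j) * D)
    ≡⟨ ∑-cong (allFin (length ts)) term ⟩
  ∑[ j ← allFin (length ts) ] (⟦ canEnterAt ts j ⟧ * entryWeight 0 ts j * (factorial n * N))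
    ≡⟨ ∑-*ʳ (allFin (length ts)) (factorial n * N) _ ⟩
  ∑[ j ← allFin (length ts) ] (⟦ canEnterAt ts j ⟧ * entryWeight 0 ts j) * (factorial n * N)
    ≡⟨ *-CS.x∙yz≈y∙zx _ (factorial n) N ⟩
  factorial n * (N * ∑[ j ← allFin (length ts) ] (⟦ canEnterAt ts j ⟧ * entryWeight 0 ts j))
    ≡⟨ cong (factorial n *_) (∑-entryWeight 0 ts) ⟩
  factorial n * (N * ((if allUnmarked ts then 0 else 0) + sum (sizes ts)))
    ≡⟨ cong (λ x → factorial n * (N * (x + sum (sizes ts)))) (if-eta (allUnmarked ts)) ⟩
  factorial n * (N * sum (sizes ts))
    ≡⟨ cong (λ x → factorial n * (N * x)) tot ⟩
  factorial n * (N * suc n)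
    ≡⟨ *-CS.x∙yz≈zx∙y (factorial n) N (suc n) ⟩
  factorial (suc n) * N ∎
  where
  open ≡-Reasoning
  D = denominator ts
  N = markedSizeProduct ts
  term : ∀ j → ⟦ canEnterAt ts j ⟧ * count n r (shrinkAt ts j) * D
             ≡ ⟦ canEnterAt ts j ⟧ * entryWeight 0 ts j * (factorial n * N)
  term j = begin
    ⟦ canEnterAt ts j ⟧ * count n r (shrinkAt ts j) * D
      ≡⟨ *-assoc ⟦ canEnterAt ts j ⟧ _ D ⟩
    ⟦ canEnterAt ts j ⟧ * (count n r (shrinkAt ts j) * D)
      ≡⟨ ⟦⟧-*-cong (canEnterAt ts j) (λ e → count-shrinkAt n r ts j e (count-closedForm n r (shrinkAt ts j)
           (trans (length-shrinkAt ts j) len) (suc-injective (trans (sum-sizes-shrinkAt ts j e) tot)))) ⟩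
    ⟦ canEnterAt ts j ⟧ * (entryWeight 0 ts j * (factorial n * N))
      ≡⟨ *-assoc ⟦ canEnterAt ts j ⟧ _ _ ⟨
    ⟦ canEnterAt ts j ⟧ * entryWeight 0 ts j * (factorial n * N) ∎

-- Restricted flags of type t

markBy : (t : List ℕ) → (Fin (length t) → Bool) → MarkedType
markBy []      f = []
markBy (a ∷ t) f = (a , f zero) ∷ markBy t (f ∘ suc)

length-markBy : ∀ t f → length (markBy t f) ≡ length t
length-markBy []      f = refl
length-markBy (a ∷ t) f = cong suc (length-markBy t (f ∘ suc))

sizes-markBy : ∀ t f → sizes (markBy t f) ≡ t
sizes-markBy []      f = refl
sizes-markBy (a ∷ t) f = cong (a ∷_) (sizes-markBy t (f ∘ suc))

Chain-markBy : ∀ {n} t f (S : Flag n (length t)) →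
  Chain (markBy t f) S ⇔ (Vec.lookup S (fromℕ (length t)) ≡ ⊤
                          × ∀ i → Step (List.lookup t i , f i) (Vec.lookup S (inject₁ i)) (Vec.lookup S (suc i)))
Chain-markBy []      f (X ∷ [])     = mk⇔ (_, λ ()) proj₁
Chain-markBy (a ∷ t) f (X ∷ Y ∷ S) = mk⇔
  (λ (step₀ , chain) → let top , steps = to (Chain-markBy t (f ∘ suc) (Y ∷ S)) chain in
                        top , λ { zero → step₀ ; (suc i) → steps i })
  (λ (top , steps) → steps zero , from (Chain-markBy t (f ∘ suc) (Y ∷ S)) (top , steps ∘ suc))

isRestrictedStep : ∀ {k} → Fin k → Bool
isRestrictedStep i = 1 ≤ᵇ toℕ i

marked : List ℕ → MarkedType
marked t = markBy t isRestrictedStep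

IsRestrictedFlagOfType⇔MarkedFlag : ∀ {n} t (S : Flag n (length t)) →
  IsRestrictedFlagOfType t S ⇔ MarkedFlag (marked t) S
IsRestrictedFlagOfType⇔MarkedFlag t S@(S₀ ∷ _) = mk⇔
  (λ ((S₀≡⊥ , top , ⊆s) , restricted , sized) → S₀≡⊥ , from (Chain-markBy t _ S)
     (top , λ i → ⊆s i , restricted i ∘ ≤ᵇ⇒≤ 1 (toℕ i) , sized i))
  (λ (S₀≡⊥ , chain) → let top , steps = to (Chain-markBy t _ S) chain in
     (S₀≡⊥ , top , proj₁ ∘ steps) , (λ i → proj₁ (proj₂ (steps i)) ∘ ≤⇒≤ᵇ)
     , proj₂ ∘ proj₂ ∘ steps)

numRestrictedFlags≡count : ∀ n t → numRestrictedFlags n t ≡ count n (length t) (marked t)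
numRestrictedFlags≡count n t =
  trans (length-filter≡∑ (isRestrictedFlagOfType? t) (allFlags n (length t)))
        (∑-cong (allFlags n (length t)) λ S → cong ⟦_⟧
          (does-⇔ (IsRestrictedFlagOfType⇔MarkedFlag t S) (isRestrictedFlagOfType? t S) (markedFlag? (marked t) S)))

∏-prefixSums≡markedPrefixProduct : ∀ s u →
  product (applyUpTo (λ j → s + [ u ] (suc j)) (length u)) ≡ markedPrefixProduct s (markBy u (λ _ → true))
∏-prefixSums≡markedPrefixProduct s []      = refl
∏-prefixSums≡markedPrefixProduct s (b ∷ u) =
  cong₂ _*_ (cong (s +_) (+-identityʳ b))
            (trans (cong product (applyUpTo-cong (length u) λ j → sym (+-assoc s b ([ u ] (suc j)))))
                   (∏-prefixSums≡markedPrefixProduct (s + b) u))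
  where
  applyUpTo-cong : ∀ {f g : ℕ → ℕ} m → (∀ j → f j ≡ g j) → applyUpTo f m ≡ applyUpTo g m
  applyUpTo-cong zero    f≗g = refl
  applyUpTo-cong (suc m) f≗g = cong₂ _∷_ (f≗g 0) (applyUpTo-cong m (f≗g ∘ suc))

markedSizeProduct-allMarked : ∀ u → markedSizeProduct (markBy u (λ _ → true)) ≡ product u
markedSizeProduct-allMarked []      = refl
markedSizeProduct-allMarked (b ∷ u) = cong (b *_) (markedSizeProduct-allMarked u)

allUnmarked-markBy-false : ∀ t → T (allUnmarked (markBy t (λ _ → false)))
allUnmarked-markBy-false []      = _
allUnmarked-markBy-false (a ∷ t) = allUnmarked-markBy-false t

numRestrictedFlags-closedForm : ∀ n t → sum t ≡ n →
  numRestrictedFlags n t * ([ t ] (length t) !) * factProd t ≡ factorial n * product t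
numRestrictedFlags-closedForm n []      refl = refl
numRestrictedFlags-closedForm n (a ∷ u) sum≡n = begin
  N * ((a + 0) * P) * factProd t
    ≡⟨ reorder₁ N (a + 0) P (factProd t) ⟩
  (a + 0) * (N * (1 * P * factProd t))
    ≡⟨ cong ((a + 0) *_) marked-closedForm ⟩
  (a + 0) * (factorial n * (1 * product u))
    ≡⟨ reorder₂ a (factorial n) (product u) ⟩
  factorial n * (a * product u) ∎
  where
  open ≡-Reasoning
  t = a ∷ u
  N = numRestrictedFlags n t
  P = product (applyUpTo (λ j → a + [ u ] (suc j)) (length u))
  reorder₁ : ∀ N x P F → N * (x * P) * F ≡ x * (N * (1 * P * F))
  reorder₁ = solve-∀
  reorder₂ : ∀ a f p → (a + 0) * (f * (1 * p)) ≡ f * (a * p)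
  reorder₂ = solve-∀
  marked-closedForm : N * (1 * P * factProd t) ≡ factorial n * (1 * product u)
  marked-closedForm = begin
    N * (1 * P * factProd t)
      ≡⟨ cong₂ (λ x y → x * (1 * y * factProd t))
               (numRestrictedFlags≡count n t) (∏-prefixSums≡markedPrefixProduct a u) ⟩
    count n (length t) (marked t) * (markedPrefixProduct 0 (marked t) * factProd t)
      ≡⟨ cong (λ x → count n (length t) (marked t) * (markedPrefixProduct 0 (marked t) * factProd x))
              (sizes-markBy t isRestrictedStep) ⟨
    count n (length t) (marked t) * denominator (marked t)
      ≡⟨ count-closedForm n (length t) (marked t) (length-markBy t isRestrictedStep)
                          (trans (cong sum (sizes-markBy t isRestrictedStep)) sum≡n) ⟩
    factorial n * markedSizeProduct (marked t)
      ≡⟨ cong (λ x → factorial n * (1 * x)) (markedSizeProduct-allMarked u) ⟩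
    factorial n * (1 * product u) ∎

-- The closed form of the unmarked type shows that factProd t divides n!.
factorial≡multinomial*factProd : ∀ n t → sum t ≡ n → factorial n ≡ multinomial n t * factProd t
factorial≡multinomial*factProd n t sum≡n =
  trans factorial≡count*factProd (cong (_* factProd t) (sym multinomial≡count))
  where
  open ≡-Reasoning
  instance _ = factProd≢0 t
  unmarked = markBy t (λ _ → false)
  M = count n (length t) unmarked
  factorial≡count*factProd : factorial n ≡ M * factProd t
  factorial≡count*factProd = begin
    factorial n                               ≡⟨ *-identityʳ (factorial n) ⟨
    factorial n * 1
      ≡⟨ cong (factorial n *_) (markedSizeProduct-allUnmarked unmarked (allUnmarked-markBy-false t)) ⟨
    factorial n * markedSizeProduct unmarked
      ≡⟨ count-closedForm n (length t) unmarked (length-markBy t _) (trans (cong sum (sizes-markBy t _)) sum≡n) ⟨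
    M * denominator unmarked
      ≡⟨ cong₂ (λ x y → M * (x * factProd y))
               (markedPrefixProduct-allUnmarked 0 unmarked (allUnmarked-markBy-false t)) (sizes-markBy t _) ⟩
    M * (1 * factProd t)                      ≡⟨ cong (M *_) (*-identityˡ (factProd t)) ⟩
    M * factProd t                            ∎
  multinomial≡count : multinomial n t ≡ M
  multinomial≡count = trans (cong (_/ factProd t) factorial≡count*factProd) (m*n/n≡m M (factProd t))

[]!-suc : ∀ t i → [ t ] (suc i) ! ≡ ([ t ] i !) * ([ t ] (suc i))
[]!-suc t i = begin
  product (applyUpTo g (suc i))          ≡⟨ cong product (applyUpTo-∷ʳ g i) ⟨
  product (applyUpTo g i List.∷ʳ g i)    ≡⟨ product-++ (applyUpTo g i) (g i ∷ []) ⟩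
  product (applyUpTo g i) * (g i * 1)    ≡⟨ cong (product (applyUpTo g i) *_) (*-identityʳ (g i)) ⟩
  product (applyUpTo g i) * g i          ∎
  where
  open ≡-Reasoning
  g = λ j → [ t ] (suc j)

[]-length : ∀ t → [ t ] (length t) ≡ sum t
[]-length t = cong sum (take-all (length t) t ≤-refl)

*-[]!-pred : ∀ n t → sum t ≡ n → 1 ≤ n → n * ([ t ] (length t ∸ 1) !) ≡ [ t ] (length t) !
*-[]!-pred n []      refl ()
*-[]!-pred n (a ∷ u) refl _ = begin
  sum t * ([ t ] (length u) !)                     ≡⟨ *-comm (sum t) _ ⟩
  ([ t ] (length u) !) * sum t                     ≡⟨ cong (([ t ] (length u) !) *_) ([]-length t) ⟨
  ([ t ] (length u) !) * ([ t ] (suc (length u)))  ≡⟨ []!-suc t (length u) ⟨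
  ([ t ] (length t) !)                             ∎
  where
  open ≡-Reasoning
  t = a ∷ u

mainTheorem11 : (n : ℕ) (t : List ℕ) → IsComposition n t →
    (numRestrictedFlags n t * ([ t ] (length t) !) ≡ multinomial n t * product t)
    × (1 ≤ n → n * numRestrictedFlags n t * ([ t ] (length t ∸ 1) !) ≡ multinomial n t * product t)
mainTheorem11 n t (_ , sum≡n) = formula , formula′
  where
  open ≡-Reasoning
  N = numRestrictedFlags n t
  formula : N * ([ t ] (length t) !) ≡ multinomial n t * product t
  formula = *-cancelʳ-≡ _ _ (factProd t) {{factProd≢0 t}} (begin
    N * ([ t ] (length t) !) * factProd t   ≡⟨ numRestrictedFlags-closedForm n t sum≡n ⟩
    factorial n * product t                 ≡⟨ cong (_* product t) (factorial≡multinomial*factProd n t sum≡n) ⟩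
    multinomial n t * factProd t * product t ≡⟨ *-CS.xy∙z≈xz∙y (multinomial n t) (factProd t) (product t) ⟩
    multinomial n t * product t * factProd t ∎)
  formula′ : 1 ≤ n → n * N * ([ t ] (length t ∸ 1) !) ≡ multinomial n t * product t
  formula′ 1≤n = begin
    n * N * ([ t ] (length t ∸ 1) !)   ≡⟨ *-CS.xy∙z≈y∙xz n N _ ⟩
    N * (n * ([ t ] (length t ∸ 1) !)) ≡⟨ cong (N *_) (*-[]!-pred n t sum≡n 1≤n) ⟩
    N * ([ t ] (length t) !)           ≡⟨ formula ⟩
    multinomial n t * product t        ∎
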